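{- Let $G=(V,E)$ be an undirected graph with positive integer edge weights $w(e)$ and positive integer targets $t(v)$ for $v\in V$. Construct $H$ with demand function $f$ as follows: for each edge $e=\{x,y\}\in E$ with $\gamma=w(e)$, delete the edge and add a new triangle on vertices $a_e,b_e,c_e$; $\gamma$ new paths on three vertices each, whose first vertex is made adjacent to $x$ and whose third vertex is made adjacent to $a_e$; and $\gamma$ new paths on three vertices each, whose first vertex is made adjacent to $b_e$ and whose third vertex is made adjacent to $y$. Set $f(u)=1$ for every new vertex $u$ and $f(v)=t(v)$ for $v\in V$. Then $H$ has an $f$-dominating set of size $\sum_{e\in E}(2w(e)+1)$ if and only if $G$ has an orientation in which every $v\in V$ has weighted outdegree at least $t(v)$.
   Context: In an orientation of an edge-weighted graph, the weighted outdegree of $v$ is the sum of weights of the edges oriented out of $v$. For a graph $H$ and $f:V(H)\to\mathbb{N}$, an $f$-dominating set is a set $S\subseteq V(H)$ such that every vertex $v\notin S$ has at least $f(v)$ neighbours in $S$. -}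

module Defs where

open import Data.Nat using (ℕ; zero; suc; _+_; _*_; _≤_)
open import Data.Fin using (Fin; zero; suc)
open import Data.Product using (Σ; _×_; _,_; proj₁; proj₂; ∃)
open import Data.Bool using (Bool; true; false; if_then_else_)
open import Data.List using (List; length)
open import Data.List.Membership.Propositional using (_∈_)
open import Data.List.Relation.Unary.All using (All)
open import Data.List.Relation.Unary.Unique.Propositional using (Unique)
open import Relation.Binary.PropositionalEquality using (_≡_; _≢_)
open import Relation.Nullary using (¬_)
open import Relation.Nullary.Decidable using (⌊_⌋)
open import Data.Fin using (_≟_)

sumFin : (m : ℕ) → (Fin m → ℕ) → ℕ
sumFin zero    g = 0
sumFin (suc m) g = g zero + sumFin m (λ i → g (suc i))

Loopless : {n m : ℕ} → (Fin m → Fin n × Fin n) → Set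
Loopless ends = ∀ e → proj₁ (ends e) ≢ proj₂ (ends e)

SameUnordered : {n : ℕ} → Fin n × Fin n → Fin n × Fin n → Set
SameUnordered (x , y) (x' , y') = (x ≡ x' × y ≡ y') Data.Sum.⊎ (x ≡ y' × y ≡ x')
  where import Data.Sum

NoParallel : {n m : ℕ} → (Fin m → Fin n × Fin n) → Set
NoParallel ends = ∀ e e' → SameUnordered (ends e) (ends e') → e ≡ e'

-- Orientation: o e = true orients e from proj₁ (ends e) to proj₂ (ends e),
-- o e = false orients it the other way.
tailOf : {n m : ℕ} → (Fin m → Fin n × Fin n) → (Fin m → Bool) → Fin m → Fin n
tailOf ends o e = if o e then proj₁ (ends e) else proj₂ (ends e)

weightedOutdeg : {n m : ℕ} → (Fin m → Fin n × Fin n) → (Fin m → ℕ) →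
                 (Fin m → Bool) → Fin n → ℕ
weightedOutdeg {m = m} ends w o v =
  sumFin m (λ e → if ⌊ tailOf ends o e ≟ v ⌋ then w e else 0)

HasGoodOrientation : {n m : ℕ} → (Fin m → Fin n × Fin n) → (Fin m → ℕ) →
                     (Fin n → ℕ) → Set
HasGoodOrientation {m = m} ends w t =
  Σ (Fin m → Bool) λ o → ∀ v → t v ≤ weightedOutdeg ends w o v

module Gadget {n m : ℕ} (ends : Fin m → Fin n × Fin n) (w : Fin m → ℕ) where

  -- Vertices of H.
  --   old v        : original vertex v ∈ V
  --   tri e i      : triangle vertex of edge e (i = 0,1,2 is a_e, b_e, c_e)
  --   lp e k j     : j-th vertex (j = 0,1,2) of the k-th path (k < w e)
  --                  joining x to a_e, where ends e = (x , y)
  --   rp e k j     : j-th vertex of the k-th path joining b_e to y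
  data HV : Set where
    old : Fin n → HV
    tri : Fin m → Fin 3 → HV
    lp  : (e : Fin m) → Fin (w e) → Fin 3 → HV
    rp  : (e : Fin m) → Fin (w e) → Fin 3 → HV

  aV bV : Fin m → HV
  aV e = tri e zero
  bV e = tri e (suc zero)

  data E₀ : HV → HV → Set where
    triE   : ∀ e (i j : Fin 3) → i ≢ j → E₀ (tri e i) (tri e j)
    lp01   : ∀ e k → E₀ (lp e k zero) (lp e k (suc zero))
    lp12   : ∀ e k → E₀ (lp e k (suc zero)) (lp e k (suc (suc zero)))
    lpX    : ∀ e k → E₀ (old (proj₁ (ends e))) (lp e k zero)
    lpA    : ∀ e k → E₀ (lp e k (suc (suc zero))) (aV e)
    rp01   : ∀ e k → E₀ (rp e k zero) (rp e k (suc zero))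
    rp12   : ∀ e k → E₀ (rp e k (suc zero)) (rp e k (suc (suc zero)))
    rpB    : ∀ e k → E₀ (bV e) (rp e k zero)
    rpY    : ∀ e k → E₀ (rp e k (suc (suc zero))) (old (proj₂ (ends e)))

  -- Adjacency in H (symmetric closure; original edges of G are deleted).
  Adj : HV → HV → Set
  Adj u v = E₀ u v Data.Sum.⊎ E₀ v u
    where import Data.Sum

  demand : (t : Fin n → ℕ) → HV → ℕ
  demand t (old v)    = t v
  demand t (tri _ _)  = 1
  demand t (lp _ _ _) = 1
  demand t (rp _ _ _) = 1

  AtLeastNbrsIn : List HV → HV → ℕ → Set
  AtLeastNbrsIn S v k =
    Σ (List HV) λ L → Unique L × All (_∈ S) L × All (Adj v) L × k ≤ length L

  IsFDominating : (Fin n → ℕ) → List HV → Set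
  IsFDominating t S = ∀ v → ¬ (v ∈ S) → AtLeastNbrsIn S v (demand t v)

  HasFDomSetOfSize : (Fin n → ℕ) → ℕ → Set
  HasFDomSetOfSize t K =
    Σ (List HV) λ S → Unique S × length S ≡ K × IsFDominating t S

{-# OPTIONS --safe #-}

-- The vertices of H outside V fall into K = Σₑ (2 w(e) + 1) blocks: the triangle of each edge
-- and each of its paths. The closed neighbourhoods of c_e and of the middle vertex of a path lie
-- inside their block, so an f-dominating set meets every block, and one of size K contains
-- exactly one vertex of each block and no vertex of V.
-- Orienting e = {x, y} away from x corresponds to choosing a_e, the first vertex of each x-side
-- path and the middle vertex of each y-side path (away from y: b_e, the middle x-side and the
-- last y-side vertices); a vertex v of V then has exactly its weighted outdegree many chosen
-- neighbours. Conversely, a chosen first vertex of an x-side path forces a_e (the third vertex of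
-- that path must be dominated from outside the block), a chosen last vertex of a y-side path
-- forces b_e, and a_e, b_e exclude each other; so orienting e away from x iff a_e is chosen gives
-- every v at least as much out-weight as it has neighbours in the set.

module Submission where

open import Defs
open import Data.Nat using (ℕ; _+_; _*_; _≤_)
open import Data.Fin using (Fin)
open import Data.Product using (_×_)
open import Function.Bundles using (_⇔_)

open import Data.Nat using (zero; suc; z≤n; s≤s)
open import Data.Nat.Properties using (≤-refl; ≤-reflexive; ≤-trans; ≤⇒≯; module ≤-Reasoning)
open import Data.Nat.Tactic.RingSolver using (solve-∀)
import Data.Fin as Fin
open import Data.Fin.Patterns using (0F; 1F; 2F)
open import Data.Product using (Σ; ∃; _,_; proj₁; proj₂)
import Data.Product.Properties as ×
import Data.Sum.Properties as ⊎
open import Data.Bool using (Bool; true; false; if_then_else_)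
import Data.Bool.Properties as Bool
open import Data.Maybe as Maybe using (Maybe; just; nothing)
open import Data.Maybe.Properties using (just-injective)
open import Function using (id; _∘_)
open import Function.Bundles using (mk⇔; mk↣)
open import Function.Definitions using (Injective)
open import Data.Sum using (_⊎_; inj₁; inj₂)
open import Data.List using (List; []; _∷_; _++_; [_]; map; concatMap; length; tabulate; allFin)
open import Data.List.Properties using (length-++; length-map; length-tabulate; length-removeAt′)
open import Data.List.Relation.Unary.Any using (here; there; index; satisfied; _─_)
open import Data.List.Relation.Unary.All as All using (All; []; _∷_)
import Data.List.Relation.Unary.All.Properties as All
open import Data.List.Relation.Unary.Unique.Propositional using (Unique; []; _∷_)
import Data.List.Relation.Unary.Unique.Propositional.Properties as Unique
open import Data.List.Relation.Binary.Subset.Propositional using (_⊆_)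
open import Data.List.Relation.Binary.Disjoint.Propositional using (Disjoint)
open import Data.List.Membership.Propositional using (_∈_; lose)
open import Data.List.Membership.Propositional.Properties
  using (∈-map⁺; ∈-map⁻; ∈-concatMap⁺; ∈-concatMap⁻; ∈-++⁺ˡ; ∈-++⁺ʳ; ∈-tabulate⁺; ∈-tabulate⁻;
         ∈-allFin)
open import Relation.Binary.Definitions using (DecidableEquality)
open import Relation.Binary.PropositionalEquality
  using (_≡_; _≢_; refl; sym; trans; cong; cong₂; ≢-sym; module ≡-Reasoning)
open import Relation.Nullary using (¬_; yes; no; contradiction)
open import Relation.Nullary.Decidable using (⌊_⌋; does; via-injection; dec-true; dec-false)

module _ {A : Set} where

  ∈-─⁺ : ∀ {x y} {ys : List A} (x∈ys : x ∈ ys) → y ∈ ys → y ≢ x → y ∈ (ys ─ x∈ys)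
  ∈-─⁺ (here refl) (here refl) y≢x = contradiction refl y≢x
  ∈-─⁺ (here refl) (there y∈ys) _  = y∈ys
  ∈-─⁺ (there _)   (here refl)  _  = here refl
  ∈-─⁺ (there x∈ys) (there y∈ys) y≢x = there (∈-─⁺ x∈ys y∈ys y≢x)

  Unique⇒length≤ : ∀ {xs ys : List A} → Unique xs → xs ⊆ ys → length xs ≤ length ys
  Unique⇒length≤ {[]}     _              _     = z≤n
  Unique⇒length≤ {x ∷ xs} {ys} (x∉xs ∷ xs!) xs⊆ys = begin
    suc (length xs)           ≤⟨ s≤s (Unique⇒length≤ xs! xs⊆ys─x) ⟩
    suc (length (ys ─ x∈ys))  ≡⟨ sym (length-removeAt′ ys (index x∈ys)) ⟩
    length ys                 ∎
    where
      open ≤-Reasoning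
      x∈ys : x ∈ ys
      x∈ys = xs⊆ys (here refl)
      xs⊆ys─x : xs ⊆ (ys ─ x∈ys)
      xs⊆ys─x y∈xs = ∈-─⁺ x∈ys (xs⊆ys (there y∈xs)) (≢-sym (All.lookup x∉xs y∈xs))

  module _ (_≟_ : DecidableEquality A) where
    open import Data.List.Membership.DecPropositional _≟_ using (_∈?_)

    Unique∧⊆∧length≥⇒⊇ : ∀ {xs ys : List A} →
                         Unique xs → xs ⊆ ys → length ys ≤ length xs → ys ⊆ xs
    Unique∧⊆∧length≥⇒⊇ {xs} {ys} xs! xs⊆ys ys≤xs {y} y∈ys with y ∈? xs
    ... | yes y∈xs = y∈xs
    ... | no  y∉xs = contradiction (Unique⇒length≤ y∷xs! y∷xs⊆ys) (≤⇒≯ ys≤xs)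
      where
        y∷xs! : Unique (y ∷ xs)
        y∷xs! = All.tabulate (λ { x∈xs refl → y∉xs x∈xs }) ∷ xs!
        y∷xs⊆ys : y ∷ xs ⊆ ys
        y∷xs⊆ys (here refl) = y∈ys
        y∷xs⊆ys (there x∈xs) = xs⊆ys x∈xs

  Unique-concatMap⁺ : ∀ {B : Set} {f : B → List A} {xs : List B} →
                      Unique xs → (∀ x → Unique (f x)) → (∀ {x y} → x ≢ y → Disjoint (f x) (f y)) →
                      Unique (concatMap f xs)
  Unique-concatMap⁺ {xs = []}     _             _   _        = []
  Unique-concatMap⁺ {f = f} {xs = x ∷ xs} (x∉xs ∷ xs!) f! disjoint =
    Unique.++⁺ (f! x) (Unique-concatMap⁺ xs! f! disjoint) λ (v∈fx , v∈rest) →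
      All.All¬⇒¬Any (All.map (λ x≢y v∈fy → disjoint x≢y (v∈fx , v∈fy)) x∉xs)
                    (∈-concatMap⁻ f v∈rest)

  label⇒Disjoint : ∀ {C : Set} (label : A → C) {c c' : C} {xs ys : List A} → c ≢ c' →
                   All (λ x → label x ≡ c) xs → All (λ y → label y ≡ c') ys → Disjoint xs ys
  label⇒Disjoint label c≢c' xs-c ys-c' (v∈xs , v∈ys) =
    c≢c' (trans (sym (All.lookup xs-c v∈xs)) (All.lookup ys-c' v∈ys))

  length-concatMap-tabulate : ∀ {B : Set} {k} (f : B → List A) (g : Fin k → B) →
                              length (concatMap f (tabulate g)) ≡ sumFin k (λ i → length (f (g i)))
  length-concatMap-tabulate {k = zero}  f g = refl
  length-concatMap-tabulate {k = suc k} f g =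
    trans (length-++ (f (g 0F)))
          (cong (length (f (g 0F)) +_) (length-concatMap-tabulate f (λ i → g (Fin.suc i))))

sumFin-cong : ∀ k {g h : Fin k → ℕ} → (∀ i → g i ≡ h i) → sumFin k g ≡ sumFin k h
sumFin-cong zero    _   = refl
sumFin-cong (suc k) g≗h = cong₂ _+_ (g≗h 0F) (sumFin-cong k (λ i → g≗h (Fin.suc i)))

module _ {n m : ℕ} (ends : Fin m → Fin n × Fin n) (w : Fin m → ℕ) where
  open Gadget ends w

  private
    Code : Set
    Code = Fin n ⊎ Fin m × Fin 3 ⊎ Bool × Σ (Fin m) (λ e → Fin (w e) × Fin 3)

    encode : HV → Code
    encode (old v)    = inj₁ v
    encode (tri e i)  = inj₂ (inj₁ (e , i))
    encode (lp e k j) = inj₂ (inj₂ (true , e , k , j))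
    encode (rp e k j) = inj₂ (inj₂ (false , e , k , j))

    decode : Code → HV
    decode (inj₁ v)                          = old v
    decode (inj₂ (inj₁ (e , i)))             = tri e i
    decode (inj₂ (inj₂ (true , e , k , j)))  = lp e k j
    decode (inj₂ (inj₂ (false , e , k , j))) = rp e k j

    decode-encode : ∀ u → decode (encode u) ≡ u
    decode-encode (old _)    = refl
    decode-encode (tri _ _)  = refl
    decode-encode (lp _ _ _) = refl
    decode-encode (rp _ _ _) = refl

    encode-injective : Injective _≡_ _≡_ encode
    encode-injective {u} {u'} eq = trans (sym (decode-encode u)) (trans (cong decode eq) (decode-encode u'))

  _≟ᴴ_ : DecidableEquality HV
  _≟ᴴ_ = via-injection (mk↣ encode-injective)
    (⊎.≡-dec Fin._≟_ (⊎.≡-dec (×.≡-dec Fin._≟_ Fin._≟_)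
                              (×.≡-dec Bool._≟_ (×.≡-dec Fin._≟_ (×.≡-dec Fin._≟_ Fin._≟_)))))

  oneNbr : ∀ {S u c} → c ∈ S → Adj u c → AtLeastNbrsIn S u 1
  oneNbr {c = c} c∈S u~c = [ c ] , [] ∷ [] , c∈S ∷ [] , u~c ∷ [] , ≤-refl

  someNbr : ∀ {S u k} → AtLeastNbrsIn S u k → 1 ≤ k → ∃ λ c → c ∈ S × Adj u c
  someNbr (c ∷ _ , _ , c∈S ∷ _ , u~c ∷ _ , _) _   = c , c∈S , u~c
  someNbr ([] , _ , _ , _ , k≤0)             1≤k = contradiction (≤-trans 1≤k k≤0) λ ()

  data Block : Set where
    triangle            : Fin m → Block
    leftPath rightPath  : (e : Fin m) → Fin (w e) → Block

  blockOf : HV → Maybe Block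
  blockOf (old _)    = nothing
  blockOf (tri e _)  = just (triangle e)
  blockOf (lp e k _) = just (leftPath e k)
  blockOf (rp e k _) = just (rightPath e k)

  edgeOfBlock : Block → Fin m
  edgeOfBlock (triangle e)    = e
  edgeOfBlock (leftPath e _)  = e
  edgeOfBlock (rightPath e _) = e

  edgeOf : HV → Maybe (Fin m)
  edgeOf u = Maybe.map edgeOfBlock (blockOf u)

  blocksAt : Fin m → List Block
  blocksAt e = triangle e ∷ tabulate (leftPath e) ++ tabulate (rightPath e)

  blocks : List Block
  blocks = concatMap blocksAt (allFin m)

  ∈-blocks : ∀ b → b ∈ blocks
  ∈-blocks b = ∈-concatMap⁺ blocksAt (lose (∈-allFin (edgeOfBlock b)) (∈-blocksAt b))
    where
      ∈-blocksAt : ∀ b → b ∈ blocksAt (edgeOfBlock b)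
      ∈-blocksAt (triangle e)    = here refl
      ∈-blocksAt (leftPath e k)  = there (∈-++⁺ˡ (∈-tabulate⁺ k))
      ∈-blocksAt (rightPath e k) = there (∈-++⁺ʳ (tabulate (leftPath e)) (∈-tabulate⁺ k))

  Unique-blocks : Unique blocks
  Unique-blocks = Unique-concatMap⁺ (Unique.allFin⁺ m) Unique-blocksAt
    (λ e≢e' → label⇒Disjoint edgeOfBlock e≢e' (edgeOf-blocksAt _) (edgeOf-blocksAt _))
    where
      edgeOf-blocksAt : ∀ e → All (λ b → edgeOfBlock b ≡ e) (blocksAt e)
      edgeOf-blocksAt e =
        refl ∷ All.++⁺ (All.tabulate⁺ {f = leftPath e} λ _ → refl) (All.tabulate⁺ {f = rightPath e} λ _ → refl)

      left∩right≡∅ : ∀ {e} → Disjoint (tabulate (leftPath e)) (tabulate (rightPath e))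
      left∩right≡∅ (p , q) with ∈-tabulate⁻ p | ∈-tabulate⁻ q
      ... | _ , refl | _ , ()

      Unique-blocksAt : ∀ e → Unique (blocksAt e)
      Unique-blocksAt e =
        All.++⁺ (All.tabulate⁺ {f = leftPath e} λ _ ()) (All.tabulate⁺ {f = rightPath e} λ _ ())
        ∷ Unique.++⁺ (Unique.tabulate⁺ λ { refl → refl }) (Unique.tabulate⁺ λ { refl → refl }) left∩right≡∅

  length-blocks : length blocks ≡ sumFin m (λ e → 2 * w e + 1)
  length-blocks = trans (length-concatMap-tabulate blocksAt id) (sumFin-cong m length-blocksAt)
    where
      length-blocksAt : ∀ e → length (blocksAt e) ≡ 2 * w e + 1
      length-blocksAt e = begin
        suc (length (tabulate (leftPath e) ++ tabulate (rightPath e)))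
          ≡⟨ cong suc (length-++ (tabulate (leftPath e))) ⟩
        suc (length (tabulate (leftPath e)) + length (tabulate (rightPath e)))
          ≡⟨ cong suc (cong₂ _+_ (length-tabulate (leftPath e)) (length-tabulate (rightPath e))) ⟩
        suc (w e + w e)
          ≡⟨ suc-double (w e) ⟩
        2 * w e + 1
          ∎
        where
          open ≡-Reasoning
          suc-double : ∀ x → suc (x + x) ≡ 2 * x + 1
          suc-double = solve-∀

  PicksInBlock : (Block → HV) → Set
  PicksInBlock f = ∀ b → blockOf (f b) ≡ just b

  Unique-map-picks : ∀ {f} → PicksInBlock f → Unique (map f blocks)
  Unique-map-picks picks = Unique.map⁺ (λ {b} {b'} fb≡fb' →
    just-injective (trans (sym (picks b)) (trans (cong blockOf fb≡fb') (picks b')))) Unique-blocks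

  length-map-blocks : ∀ (f : Block → HV) → length (map f blocks) ≡ sumFin m (λ e → 2 * w e + 1)
  length-map-blocks f = trans (length-map f blocks) length-blocks

  center : Block → HV
  center (triangle e)    = tri e 2F
  center (leftPath e k)  = lp e k 1F
  center (rightPath e k) = rp e k 1F

  blockOf-center : PicksInBlock center
  blockOf-center (triangle _)    = refl
  blockOf-center (leftPath _ _)  = refl
  blockOf-center (rightPath _ _) = refl

  Adj-center⇒inBlock : ∀ b {u} → Adj (center b) u → blockOf u ≡ just b
  Adj-center⇒inBlock (triangle _)    (inj₁ (triE _ _ _ _)) = refl
  Adj-center⇒inBlock (triangle _)    (inj₂ (triE _ _ _ _)) = refl
  Adj-center⇒inBlock (leftPath _ _)  (inj₁ (lp12 _ _))     = refl
  Adj-center⇒inBlock (leftPath _ _)  (inj₂ (lp01 _ _))     = refl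
  Adj-center⇒inBlock (rightPath _ _) (inj₁ (rp12 _ _))     = refl
  Adj-center⇒inBlock (rightPath _ _) (inj₂ (rp01 _ _))     = refl

  1≤demand-center : ∀ t b → 1 ≤ demand t (center b)
  1≤demand-center _ (triangle _)    = ≤-refl
  1≤demand-center _ (leftPath _ _)  = ≤-refl
  1≤demand-center _ (rightPath _ _) = ≤-refl

  choose : Bool → Block → HV
  choose β (triangle e)    = tri e (if β then 0F else 1F)
  choose β (leftPath e k)  = lp e k (if β then 0F else 1F)
  choose β (rightPath e k) = rp e k (if β then 1F else 2F)

  blockOf-choose : ∀ β → PicksInBlock (choose β)
  blockOf-choose _ (triangle _)    = refl
  blockOf-choose _ (leftPath _ _)  = refl
  blockOf-choose _ (rightPath _ _) = refl

  endpoint : Fin m → Bool → Fin n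
  endpoint e β = if β then proj₁ (ends e) else proj₂ (ends e)

  endpointNbrs : Fin m → Bool → List HV
  endpointNbrs e true  = tabulate (λ k → lp e k 0F)
  endpointNbrs e false = tabulate (λ k → rp e k 2F)

  ∈-endpointNbrs⇒Adj : ∀ e β {u} → u ∈ endpointNbrs e β → Adj (old (endpoint e β)) u
  ∈-endpointNbrs⇒Adj e true  p with ∈-tabulate⁻ p
  ... | k , refl = inj₁ (lpX e k)
  ∈-endpointNbrs⇒Adj e false p with ∈-tabulate⁻ p
  ... | k , refl = inj₂ (rpY e k)

  outNbrsVia : (Fin m → Bool) → Fin n → Fin m → List HV
  outNbrsVia o v e = if ⌊ tailOf ends o e Fin.≟ v ⌋ then endpointNbrs e (o e) else []

  outNbrs : (Fin m → Bool) → Fin n → List HV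
  outNbrs o v = concatMap (outNbrsVia o v) (allFin m)

  module _ (o : Fin m → Bool) (v : Fin n) where

    ∈-outNbrsVia⁻ : ∀ {e u} → u ∈ outNbrsVia o v e →
                    tailOf ends o e ≡ v × u ∈ endpointNbrs e (o e)
    ∈-outNbrsVia⁻ {e} p with tailOf ends o e Fin.≟ v
    ... | yes tail≡v = tail≡v , p
    ... | no _ with () ← p

    ∈-outNbrs⁻ : ∀ {u} → u ∈ outNbrs o v →
                 ∃ λ e → tailOf ends o e ≡ v × u ∈ endpointNbrs e (o e)
    ∈-outNbrs⁻ p with satisfied (∈-concatMap⁻ (outNbrsVia o v) {xs = allFin m} p)
    ... | e , q = e , ∈-outNbrsVia⁻ q

    ∈-outNbrs⇒Adj : ∀ {u} → u ∈ outNbrs o v → Adj (old v) u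
    ∈-outNbrs⇒Adj p with ∈-outNbrs⁻ p
    ... | e , refl , q = ∈-endpointNbrs⇒Adj e (o e) q

    length-outNbrs : length (outNbrs o v) ≡ weightedOutdeg ends w o v
    length-outNbrs = trans (length-concatMap-tabulate (outNbrsVia o v) id) (sumFin-cong m length-outNbrsVia)
      where
        length-endpointNbrs : ∀ e β → length (endpointNbrs e β) ≡ w e
        length-endpointNbrs e true  = length-tabulate _
        length-endpointNbrs e false = length-tabulate _

        length-outNbrsVia : ∀ e →
                            length (outNbrsVia o v e) ≡ (if ⌊ tailOf ends o e Fin.≟ v ⌋ then w e else 0)
        length-outNbrsVia e with ⌊ tailOf ends o e Fin.≟ v ⌋
        ... | true  = length-endpointNbrs e (o e)
        ... | false = refl

    Unique-outNbrs : Unique (outNbrs o v)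
    Unique-outNbrs = Unique-concatMap⁺ (Unique.allFin⁺ m) Unique-outNbrsVia
      (λ e≢e' → label⇒Disjoint edgeOf (e≢e' ∘ just-injective)
                                (edgeOf-outNbrsVia _) (edgeOf-outNbrsVia _))
      where
        Unique-endpointNbrs : ∀ e β → Unique (endpointNbrs e β)
        Unique-endpointNbrs e true  = Unique.tabulate⁺ λ { refl → refl }
        Unique-endpointNbrs e false = Unique.tabulate⁺ λ { refl → refl }

        Unique-outNbrsVia : ∀ e → Unique (outNbrsVia o v e)
        Unique-outNbrsVia e with ⌊ tailOf ends o e Fin.≟ v ⌋
        ... | true  = Unique-endpointNbrs e (o e)
        ... | false = []

        edgeOf-endpointNbrs : ∀ e β → All (λ u → edgeOf u ≡ just e) (endpointNbrs e β)
        edgeOf-endpointNbrs e true  = All.tabulate⁺ λ _ → refl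
        edgeOf-endpointNbrs e false = All.tabulate⁺ λ _ → refl

        edgeOf-outNbrsVia : ∀ e → All (λ u → edgeOf u ≡ just e) (outNbrsVia o v e)
        edgeOf-outNbrsVia e with ⌊ tailOf ends o e Fin.≟ v ⌋
        ... | true  = edgeOf-endpointNbrs e (o e)
        ... | false = []

  ∈-outNbrs⁺ : ∀ {o e β u} → o e ≡ β → u ∈ endpointNbrs e β → u ∈ outNbrs o (endpoint e β)
  ∈-outNbrs⁺ {o} {e} refl p = ∈-concatMap⁺ (outNbrsVia o (tailOf ends o e)) (lose (∈-allFin e) q)
    where
      q : _ ∈ outNbrsVia o (tailOf ends o e) e
      q with tailOf ends o e Fin.≟ tailOf ends o e
      ... | yes _  = p
      ... | no tail≢tail = contradiction refl tail≢tail

  module FromOrientation (t : Fin n → ℕ) (o : Fin m → Bool)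
                         (good : ∀ v → t v ≤ weightedOutdeg ends w o v) where

    pick : Block → HV
    pick b = choose (o (edgeOfBlock b)) b

    S : List HV
    S = map pick blocks

    picked : ∀ b {β} → o (edgeOfBlock b) ≡ β → choose β b ∈ S
    picked b refl = ∈-map⁺ pick (∈-blocks b)

    tri-dominated : ∀ e i → ¬ tri e i ∈ S → AtLeastNbrsIn S (tri e i) 1
    tri-dominated e i i∉S = oneNbr c∈S (inj₁ (triE e i _ λ { refl → i∉S c∈S }))
      where
        c∈S : pick (triangle e) ∈ S
        c∈S = picked (triangle e) refl

    lp-dominated : ∀ e k j → ¬ lp e k j ∈ S → AtLeastNbrsIn S (lp e k j) 1
    lp-dominated e k j j∉S with o e in oe
    lp-dominated e k 0F j∉S | true  = contradiction (picked (leftPath e k) oe) j∉S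
    lp-dominated e k 1F _   | true  = oneNbr (picked (leftPath e k) oe) (inj₂ (lp01 e k))
    lp-dominated e k 2F _   | true  = oneNbr (picked (triangle e) oe) (inj₁ (lpA e k))
    lp-dominated e k 0F _   | false = oneNbr (picked (leftPath e k) oe) (inj₁ (lp01 e k))
    lp-dominated e k 1F j∉S | false = contradiction (picked (leftPath e k) oe) j∉S
    lp-dominated e k 2F _   | false = oneNbr (picked (leftPath e k) oe) (inj₂ (lp12 e k))

    rp-dominated : ∀ e k j → ¬ rp e k j ∈ S → AtLeastNbrsIn S (rp e k j) 1
    rp-dominated e k j j∉S with o e in oe
    rp-dominated e k 0F _   | true  = oneNbr (picked (rightPath e k) oe) (inj₁ (rp01 e k))
    rp-dominated e k 1F j∉S | true  = contradiction (picked (rightPath e k) oe) j∉S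
    rp-dominated e k 2F _   | true  = oneNbr (picked (rightPath e k) oe) (inj₂ (rp12 e k))
    rp-dominated e k 0F _   | false = oneNbr (picked (triangle e) oe) (inj₂ (rpB e k))
    rp-dominated e k 1F _   | false = oneNbr (picked (rightPath e k) oe) (inj₁ (rp12 e k))
    rp-dominated e k 2F j∉S | false = contradiction (picked (rightPath e k) oe) j∉S

    endpointNbrs⊆S : ∀ e {u} → u ∈ endpointNbrs e (o e) → u ∈ S
    endpointNbrs⊆S e p with o e in oe
    ... | true  with k , refl ← ∈-tabulate⁻ p = picked (leftPath e k) oe
    ... | false with k , refl ← ∈-tabulate⁻ p = picked (rightPath e k) oe

    old-dominated : ∀ v → AtLeastNbrsIn S (old v) (t v)
    old-dominated v = outNbrs o v , Unique-outNbrs o v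
                    , All.tabulate (λ p → let e , _ , q = ∈-outNbrs⁻ o v p in endpointNbrs⊆S e q)
                    , All.tabulate (∈-outNbrs⇒Adj o v)
                    , ≤-trans (good v) (≤-reflexive (sym (length-outNbrs o v)))

    dominating : IsFDominating t S
    dominating (old v)    _ = old-dominated v
    dominating (tri e i)    = tri-dominated e i
    dominating (lp e k j)   = lp-dominated e k j
    dominating (rp e k j)   = rp-dominated e k j

    hasFDomSet : HasFDomSetOfSize t (sumFin m (λ e → 2 * w e + 1))
    hasFDomSet = S , Unique-map-picks (λ b → blockOf-choose (o (edgeOfBlock b)) b)
               , length-map-blocks pick , dominating

  module ToOrientation (t : Fin n → ℕ) (S : List HV)
                       (|S|≡K : length S ≡ sumFin m (λ e → 2 * w e + 1))
                       (dominating : IsFDominating t S) where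
    open import Data.List.Membership.DecPropositional _≟ᴴ_ using (_∈?_)

    closedNbr : ∀ u → 1 ≤ demand t u → ∃ λ c → c ∈ S × (c ≡ u ⊎ Adj u c)
    closedNbr u 1≤f with u ∈? S
    ... | yes u∈S = u , u∈S , inj₁ refl
    ... | no  u∉S = let c , c∈S , u~c = someNbr (dominating u u∉S) 1≤f in c , c∈S , inj₂ u~c

    meetsBlock : ∀ b → ∃ λ u → u ∈ S × blockOf u ≡ just b
    meetsBlock b with closedNbr (center b) (1≤demand-center t b)
    ... | c , c∈S , inj₁ refl = c , c∈S , blockOf-center b
    ... | c , c∈S , inj₂ b~c  = c , c∈S , Adj-center⇒inBlock b b~c

    rep : Block → HV
    rep b = proj₁ (meetsBlock b)

    rep∈S : ∀ b → rep b ∈ S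
    rep∈S b = proj₁ (proj₂ (meetsBlock b))

    blockOf-rep : PicksInBlock rep
    blockOf-rep b = proj₂ (proj₂ (meetsBlock b))

    reps⊆S : map rep blocks ⊆ S
    reps⊆S p with b , _ , refl ← ∈-map⁻ rep p = rep∈S b

    -- S has no more elements than there are blocks, so the representatives exhaust it.
    ∈S⇒rep : ∀ {u} → u ∈ S → ∃ λ b → u ≡ rep b
    ∈S⇒rep u∈S
      with b , _ , u≡rep ← ∈-map⁻ rep (Unique∧⊆∧length≥⇒⊇ _≟ᴴ_ (Unique-map-picks blockOf-rep) reps⊆S
                                          (≤-reflexive (trans |S|≡K (sym (length-map-blocks rep)))) u∈S)
      = b , u≡rep

    old∉S : ∀ v → ¬ old v ∈ S
    old∉S v p with b , eq ← ∈S⇒rep p with () ← trans (cong blockOf eq) (blockOf-rep b)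

    sameBlock⇒≡ : ∀ {u u'} → u ∈ S → u' ∈ S → blockOf u ≡ blockOf u' → u ≡ u'
    sameBlock⇒≡ p p' eq with b , refl ← ∈S⇒rep p | b' , refl ← ∈S⇒rep p' =
      cong rep (just-injective (trans (sym (blockOf-rep b)) (trans eq (blockOf-rep b'))))

    a∈S⇒b∉S : ∀ {e} → aV e ∈ S → ¬ bV e ∈ S
    a∈S⇒b∉S a∈S b∈S = contradiction (sameBlock⇒≡ a∈S b∈S refl) λ ()

    lp₀∈S⇒a∈S : ∀ {e k} → lp e k 0F ∈ S → aV e ∈ S
    lp₀∈S⇒a∈S {e} {k} l∈S with closedNbr (lp e k 2F) ≤-refl
    ... | _ , c∈S , inj₁ refl             = contradiction (sameBlock⇒≡ l∈S c∈S refl) λ ()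
    ... | _ , c∈S , inj₂ (inj₁ (lpA _ _))  = c∈S
    ... | _ , c∈S , inj₂ (inj₂ (lp12 _ _)) = contradiction (sameBlock⇒≡ l∈S c∈S refl) λ ()

    rp₂∈S⇒b∈S : ∀ {e k} → rp e k 2F ∈ S → bV e ∈ S
    rp₂∈S⇒b∈S {e} {k} r∈S with closedNbr (rp e k 0F) ≤-refl
    ... | _ , c∈S , inj₁ refl             = contradiction (sameBlock⇒≡ r∈S c∈S refl) λ ()
    ... | _ , c∈S , inj₂ (inj₁ (rp01 _ _)) = contradiction (sameBlock⇒≡ r∈S c∈S refl) λ ()
    ... | _ , c∈S , inj₂ (inj₂ (rpB _ _))  = c∈S

    o : Fin m → Bool
    o e = does (aV e ∈? S)

    nbr∈S⇒outNbr : ∀ v {u} → u ∈ S → Adj (old v) u → u ∈ outNbrs o v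
    nbr∈S⇒outNbr _ u∈S (inj₁ (lpX e k)) =
      ∈-outNbrs⁺ {o = o} (dec-true (aV e ∈? S) (lp₀∈S⇒a∈S u∈S)) (∈-tabulate⁺ k)
    nbr∈S⇒outNbr _ u∈S (inj₂ (rpY e k)) =
      ∈-outNbrs⁺ {o = o} (dec-false (aV e ∈? S) λ a∈S → a∈S⇒b∉S a∈S (rp₂∈S⇒b∈S u∈S))
                         (∈-tabulate⁺ k)

    good : ∀ v → t v ≤ weightedOutdeg ends w o v
    good v with L , L! , L⊆S , L~v , t≤|L| ← dominating (old v) (old∉S v) = begin
      t v                        ≤⟨ t≤|L| ⟩
      length L                   ≤⟨ Unique⇒length≤ L! L⊆outNbrs ⟩
      length (outNbrs o v)       ≡⟨ length-outNbrs o v ⟩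
      weightedOutdeg ends w o v  ∎
      where
        open ≤-Reasoning
        L⊆outNbrs : L ⊆ outNbrs o v
        L⊆outNbrs p = nbr∈S⇒outNbr v (All.lookup L⊆S p) (All.lookup L~v p)

mainTheorem16 : (n m : ℕ) (ends : Fin m → Fin n × Fin n) (w : Fin m → ℕ) (t : Fin n → ℕ) →
    (∀ e → 1 ≤ w e) → (∀ v → 1 ≤ t v) →
    Loopless ends → NoParallel ends →
    (Gadget.HasFDomSetOfSize ends w t (sumFin m (λ e → 2 * w e + 1))
      ⇔ HasGoodOrientation ends w t)
mainTheorem16 n m ends w t _ _ _ _ = mk⇔
  (λ (S , _ , |S|≡K , dominating) → let open ToOrientation ends w t S |S|≡K dominating in o , good)
  (λ (o , good) → FromOrientation.hasFDomSet ends w t o good)
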